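{- Let $T$ and $P$ be strings and let $A[1..N]$ be a set of anchors that are exact matches between $T$ and $P$. Then \[ \max_{1\le i\le N}\ \max_{\text{weak chains } S \text{ ending at } A[i]}\mathtt{coverage}(S) \] equals the length of an anchor-restricted longest common subsequence of $T$ and $P$ with respect to $A$.
   Context: An anchor is an interval pair $I=([I.a..I.b],[I.c..I.d])$ with positive integer endpoints; it is an exact match between $T$ and $P$ if $I.b-I.a=I.d-I.c$ and $T[I.a..I.b]=P[I.c..I.d]$. Weak precedence: $I'\prec^w I$ iff $I'.a<I.a$ and $I'.c<I.c$. A weak chain ending at $A[i]$ is a sequence $S[1..n]$ ($n\ge1$) of anchors from $A$ with $S[j-1]\prec^w S[j]$ for all $1<j\le n$ and $S[n]=A[i]$, and \[ \mathtt{coverage}(S)=\sum_{j=1}^{n-1}\min\Big(\min(S[j+1].a,S[j].b+1)-S[j].a,\ \min(S[j+1].c,S[j].d+1)-S[j].c\Big)+\min\big(S[n].b-S[n].a+1,\ S[n].d-S[n].c+1\big). \] A string $C[1..\ell]$ is an anchor-restricted common subsequence of $T$ and $P$ if there are indices $1\le i_1<\dots<i_\ell\le|T|$ and $1\le j_1<\dots<j_\ell\le|P|$ with $C[k]=T[i_k]=P[j_k]$ for all $k$, such that for each $k$ there is an anchor $([a..b],[c..d])$ in $A$ and an integer $x$ with $0\le x\le b-a$, $a+x=i_k$ and $c+x=j_k$. An anchor-restricted longest common subsequence is one of maximum length $\ell$. -}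

module Defs where

open import Data.Nat using (ℕ; zero; suc; _+_; _∸_; _≤_; _<_; _⊓_)
open import Data.Fin as Fin using (Fin)
open import Data.List using (List; []; _∷_; length; lookup)
open import Data.List.Membership.Propositional using (_∈_)
open import Data.Maybe using (Maybe; just; nothing)
open import Data.Product using (Σ; _×_; ∃)
open import Relation.Binary.PropositionalEquality using (_≡_)

-- 1-based indexing of a string (list); nothing if out of range
_at_ : {Σ′ : Set} → List Σ′ → ℕ → Maybe Σ′
[] at _ = nothing
(x ∷ xs) at zero = nothing
(x ∷ xs) at suc zero = just x
(x ∷ xs) at suc (suc i) = xs at suc i

-- An anchor ([a..b],[c..d])
record Anchor : Set where
  constructor anchor
  field
    a b c d : ℕ
open Anchor public

ExactMatch : {Σ′ : Set} → List Σ′ → List Σ′ → Anchor → Set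
ExactMatch T P I =
  (1 ≤ a I) × (a I ≤ b I) × (b I ≤ length T) ×
  (1 ≤ c I) × (c I ≤ d I) × (d I ≤ length P) ×
  (b I ∸ a I ≡ d I ∸ c I) ×
  (∀ x → x ≤ b I ∸ a I → T at (a I + x) ≡ P at (c I + x))

_≺w_ : Anchor → Anchor → Set
I′ ≺w I = (a I′ < a I) × (c I′ < c I)

-- a nonempty sequence S[1..n] is given as head S[1] and tail S[2..n];
-- WeakChain A s rest : consecutive elements weakly precede, all from A
WeakChain : List Anchor → Anchor → List Anchor → Set
WeakChain A s [] = s ∈ A
WeakChain A s (t ∷ rest) = (s ∈ A) × (s ≺w t) × WeakChain A t rest

coverage : Anchor → List Anchor → ℕ
coverage s [] = (b s ∸ a s + 1) ⊓ (d s ∸ c s + 1)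
coverage s (t ∷ rest) =
  (((a t ⊓ (b s + 1)) ∸ a s) ⊓ ((c t ⊓ (d s + 1)) ∸ c s)) + coverage t rest

last : Anchor → List Anchor → Anchor
last s [] = s
last s (t ∷ rest) = last t rest

StrictlyIncreasing : {ℓ : ℕ} → (Fin ℓ → ℕ) → Set
StrictlyIncreasing f = ∀ k k′ → k Fin.< k′ → f k < f k′

ARCS : {Σ′ : Set} → List Σ′ → List Σ′ → List Anchor → List Σ′ → Set
ARCS T P A C =
  Σ (Fin (length C) → ℕ) λ i →
  Σ (Fin (length C) → ℕ) λ j →
    StrictlyIncreasing i × StrictlyIncreasing j ×
    (∀ k → 1 ≤ i k × i k ≤ length T) ×
    (∀ k → 1 ≤ j k × j k ≤ length P) ×
    (∀ k → (T at i k ≡ just (lookup C k)) × (P at j k ≡ just (lookup C k))) ×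
    (∀ k → Σ Anchor λ I → (I ∈ A) × Σ ℕ λ x →
             (x ≤ b I ∸ a I) × (a I + x ≡ i k) × (c I + x ≡ j k))

IsMaxChainCoverage : List Anchor → ℕ → Set
IsMaxChainCoverage A ℓ =
  (Σ Anchor λ s → Σ (List Anchor) λ rest →
     WeakChain A s rest × (last s rest ∈ A) × (coverage s rest ≡ ℓ)) ×
  (∀ s rest → WeakChain A s rest → last s rest ∈ A → coverage s rest ≤ ℓ)

IsARLCSLength : {Σ′ : Set} → List Σ′ → List Σ′ → List Anchor → ℕ → Set
IsARLCSLength T P A ℓ =
  (Σ _ λ C → ARCS T P A C × (length C ≡ ℓ)) ×
  (∀ C → ARCS T P A C → length C ≤ ℓ)

-- A weak chain yields an anchor-restricted common subsequence as long as its coverage: each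
-- anchor contributes the diagonal prefix that coverage counts for it, and that prefix ends before
-- the next anchor starts in both strings. Conversely, scanning a restricted common subsequence
-- from the back, each match is either prepended to the chain built so far (when its anchor weakly
-- precedes the chain's head) or already lies in the stretch counted for the head, so some chain
-- covers at least as many positions as there are matches. Chains have at most |T| anchors, so a
-- chain of maximal coverage exists and is found by dynamic programming.

module Submission where

open import Defs
open import Data.Nat using (ℕ; _≤_)
open import Data.List using (List; length)
open import Data.List.Relation.Unary.All using (All)
open import Data.Product using (Σ; _×_)

open import Data.Nat using (zero; suc; _+_; _∸_; _<_; _⊓_; z≤n; s≤s; s≤s⁻¹; _<?_)
open import Data.Nat.Properties
open import Data.Nat.Solver using (module +-*-Solver)
open import Data.Fin as Fin using (Fin)
open import Data.Fin.Properties using (∀-cons)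
import Data.Vec.Functional as Vector
open import Data.List using ([]; _∷_; map; filter)
open import Data.List.Membership.Propositional using (_∈_; lose)
open import Data.List.Membership.Propositional.Properties using (∈-map⁺; ∈-filter⁺; ∈-filter⁻)
open import Data.List.Relation.Unary.Any using (here)
import Data.List.Relation.Unary.All as All
import Data.List.Relation.Unary.All.Properties as All
open import Data.List.Extrema.Nat
  using (argmax; argmax-sel; argmax-all; v≤f[argmax]⁺; f[⊥]≤f[argmax]; f[xs]≤f[argmax])
open import Data.Maybe using (just)
open import Data.Product using (_,_; proj₁; proj₂)
open import Data.Sum using (_⊎_; inj₁; inj₂)
open import Function using (_∘_)
open import Relation.Binary.Definitions using (Decidable)
open import Relation.Binary.PropositionalEquality using (_≡_; refl; sym; trans; cong; subst; subst₂)
open import Relation.Nullary using (¬_; yes; no)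
open import Relation.Nullary.Decidable using (_×-dec_)

open ≤-Reasoning

offset-≤ : ∀ {u B x n} → u ≤ B → x ≤ B ∸ u → B ≤ n → u + x ≤ n
offset-≤ {u} {B} {x} {n} u≤B x≤ B≤n = begin
  u + x       ≤⟨ +-monoʳ-≤ u x≤ ⟩
  u + (B ∸ u) ≡⟨ m+[n∸m]≡n u≤B ⟩
  B           ≤⟨ B≤n ⟩
  n           ∎

+-offset-≤ : ∀ N x u {cov} → N + x ≤ cov → N + (u + x) ≤ cov + u
+-offset-≤ N x u {cov} le = begin
  N + (u + x) ≡⟨ cong (N +_) (+-comm u x) ⟩
  N + (x + u) ≡⟨ sym (+-assoc N x u) ⟩
  N + x + u   ≤⟨ +-monoˡ-≤ u le ⟩
  cov + u     ∎

+-shift-< : ∀ N {i₀ i₁ m} → i₀ < i₁ → N + i₁ ≤ m → suc N + i₀ ≤ m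
+-shift-< N {i₀} {i₁} {m} i₀<i₁ le = begin
  suc N + i₀ ≡⟨ sym (+-suc N i₀) ⟩
  N + suc i₀ ≤⟨ +-monoʳ-≤ N i₀<i₁ ⟩
  N + i₁     ≤⟨ le ⟩
  m          ∎

+-shift-≤ : ∀ N {v i₀ i₁ cov} → v ≤ i₀ → i₀ < i₁ → N + i₁ ≤ cov + v → suc N ≤ cov
+-shift-≤ N {v} {i₀} v≤i₀ i₀<i₁ le =
  +-cancelʳ-≤ v (suc N) _ (≤-trans (+-monoʳ-≤ (suc N) v≤i₀) (+-shift-< N i₀<i₁ le))

-- One coordinate of prepending an anchor [u..B] to a chain whose head starts at v: a match
-- at offset x of the anchor is followed by N further matches from position i₁ on.
prepend-gain : ∀ {u B v N x i₁ cov} → u ≤ B → x ≤ B ∸ u → u < v → u + x < i₁ →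
               N ≤ cov → N + i₁ ≤ cov + v → suc N + x ≤ (v ⊓ (B + 1)) ∸ u + cov
prepend-gain {u} {B} {v} {N} {x} {i₁} {cov} u≤B x≤ u<v u+x<i₁ N≤cov reach
  with ≤-total v (B + 1)
... | inj₁ v≤B+1 = begin
  suc N + x              ≤⟨ m+n≤o⇒m≤o∸n (suc N + x) (begin
    suc N + x + u          ≡⟨ solve 3 (λ N x u → con 1 :+ N :+ x :+ u := N :+ (con 1 :+ (u :+ x)))
                                      refl N x u ⟩
    N + suc (u + x)        ≤⟨ +-monoʳ-≤ N u+x<i₁ ⟩
    N + i₁                 ≤⟨ reach ⟩
    cov + v                ∎) ⟩
  cov + v ∸ u            ≡⟨ +-∸-assoc cov (<⇒≤ u<v) ⟩
  cov + (v ∸ u)          ≡⟨ +-comm cov (v ∸ u) ⟩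
  v ∸ u + cov            ≡⟨ cong (λ m → m ∸ u + cov) (sym (m≤n⇒m⊓n≡m v≤B+1)) ⟩
  v ⊓ (B + 1) ∸ u + cov  ∎
  where open +-*-Solver
... | inj₂ B+1≤v = begin
  suc N + x              ≡⟨ solve 2 (λ N x → con 1 :+ N :+ x := x :+ con 1 :+ N) refl N x ⟩
  x + 1 + N              ≤⟨ +-mono-≤ (+-monoˡ-≤ 1 x≤) N≤cov ⟩
  B ∸ u + 1 + cov        ≡⟨ cong (_+ cov) (sym (+-∸-comm 1 u≤B)) ⟩
  B + 1 ∸ u + cov        ≡⟨ cong (λ m → m ∸ u + cov) (sym (m≥n⇒m⊓n≡n B+1≤v)) ⟩
  v ⊓ (B + 1) ∸ u + cov  ∎
  where open +-*-Solver

at-inRange : ∀ {S : Set} (xs : List S) i → 1 ≤ i × i ≤ length xs → Σ S λ x → xs at i ≡ just x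
at-inRange (x ∷ xs) 1             _              = x , refl
at-inRange (x ∷ xs) (suc (suc i)) (_ , s≤s i<xs) = at-inRange xs (suc i) (s≤s z≤n , i<xs)

StrictlyIncreasing-cons : ∀ {ℓ x} {f : Fin ℓ → ℕ} →
                          (∀ k → x < f k) → StrictlyIncreasing f → StrictlyIncreasing (x Vector.∷ f)
StrictlyIncreasing-cons x<f f↑ Fin.zero     (Fin.suc k′) _          = x<f k′
StrictlyIncreasing-cons x<f f↑ (Fin.suc k)  (Fin.suc k′) (s≤s k<k′) = f↑ k k′ k<k′

StrictlyIncreasing-head : ∀ {ℓ} {f : Fin (suc (suc ℓ)) → ℕ} →
                          StrictlyIncreasing f → f Fin.zero < f (Fin.suc Fin.zero)
StrictlyIncreasing-head f↑ = f↑ Fin.zero (Fin.suc Fin.zero) (s≤s z≤n)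

StrictlyIncreasing-tail : ∀ {ℓ} {f : Fin (suc ℓ) → ℕ} →
                          StrictlyIncreasing f → StrictlyIncreasing (Vector.tail f)
StrictlyIncreasing-tail f↑ k k′ k<k′ = f↑ (Fin.suc k) (Fin.suc k′) (s≤s k<k′)

_≺w?_ : Decidable _≺w_
I ≺w? J = (a I <? a J) ×-dec (c I <? c J)

⊀w⇒≥ : ∀ {I J} → ¬ I ≺w J → a J ≤ a I ⊎ c J ≤ c I
⊀w⇒≥ {I} {J} I⊀J with a I <? a J
... | yes aI<aJ = inj₂ (≮⇒≥ (λ cI<cJ → I⊀J (aI<aJ , cI<cJ)))
... | no  aI≮aJ = inj₁ (≮⇒≥ aI≮aJ)

-- coverage s (t ∷ rest) unfolds to contribution s t + coverage t rest.
contribution : Anchor → Anchor → ℕ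
contribution s t = ((a t ⊓ (b s + 1)) ∸ a s) ⊓ ((c t ⊓ (d s + 1)) ∸ c s)

contribution≤length : ∀ s t → a s ≤ b s → contribution s t ≤ suc (b s ∸ a s)
contribution≤length s t a≤b = begin
  contribution s t          ≤⟨ m⊓n≤m _ _ ⟩
  (a t ⊓ (b s + 1)) ∸ a s   ≤⟨ ∸-monoˡ-≤ (a s) (m⊓n≤n (a t) (b s + 1)) ⟩
  b s + 1 ∸ a s             ≡⟨ +-∸-comm 1 a≤b ⟩
  b s ∸ a s + 1             ≡⟨ +-comm (b s ∸ a s) 1 ⟩
  suc (b s ∸ a s)           ∎

a+contribution≤a : ∀ s t → a s ≤ a t → a s + contribution s t ≤ a t
a+contribution≤a s t as≤at = begin
  a s + contribution s t  ≤⟨ +-monoʳ-≤ (a s) (≤-trans (m⊓n≤m _ _) (∸-monoˡ-≤ (a s) (m⊓n≤m (a t) _))) ⟩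
  a s + (a t ∸ a s)       ≡⟨ m+[n∸m]≡n as≤at ⟩
  a t                     ∎

c+contribution≤c : ∀ s t → c s ≤ c t → c s + contribution s t ≤ c t
c+contribution≤c s t cs≤ct = begin
  c s + contribution s t  ≤⟨ +-monoʳ-≤ (c s) (≤-trans (m⊓n≤n _ _) (∸-monoˡ-≤ (c s) (m⊓n≤m (c t) _))) ⟩
  c s + (c t ∸ c s)       ≡⟨ m+[n∸m]≡n cs≤ct ⟩
  c t                     ∎

WeakChain-head : ∀ {A s rest} → WeakChain A s rest → s ∈ A
WeakChain-head {rest = []}    s∈A           = s∈A
WeakChain-head {rest = _ ∷ _} (s∈A , _ , _) = s∈A

WeakChain-last : ∀ {A s rest} → WeakChain A s rest → last s rest ∈ A
WeakChain-last {rest = []}    s∈A       = s∈A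
WeakChain-last {rest = _ ∷ _} (_ , _ , w) = WeakChain-last w

WeakChain-length : ∀ {A s rest} → WeakChain A s rest → length rest + a s ≤ a (last s rest)
WeakChain-length {rest = []}         _                        = ≤-refl
WeakChain-length {s = s} {t ∷ rest} (_ , (as<at , _) , w) = begin
  suc (length rest) + a s ≡⟨ sym (+-suc (length rest) (a s)) ⟩
  length rest + suc (a s) ≤⟨ +-monoʳ-≤ (length rest) as<at ⟩
  length rest + a t       ≤⟨ WeakChain-length w ⟩
  a (last t rest)         ∎

-- The chain s ∷ rest pays for n matches, the first at (i , j): its coverage is at least
-- n + (i ∸ a s) and n + (j ∸ c s).
Covers : ℕ → ℕ → ℕ → Anchor → List Anchor → Set
Covers n i j s rest =
  n ≤ coverage s rest × n + i ≤ coverage s rest + a s × n + j ≤ coverage s rest + c s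

module OptimalChain (A : List Anchor) where

  bestTail   : ℕ → Anchor → List Anchor
  extensions : ℕ → Anchor → List (List Anchor)

  bestTail zero    s = []
  bestTail (suc n) s = argmax (coverage s) [] (extensions n s)

  extensions n s = map (λ t → t ∷ bestTail n t) (filter (s ≺w?_) A)

  bestTail-chain : ∀ n {s} → s ∈ A → WeakChain A s (bestTail n s)
  bestTail-chain zero    s∈A = s∈A
  bestTail-chain (suc n) {s} s∈A =
    argmax-all (coverage s) {P = WeakChain A s} s∈A (All.map⁺ (All.tabulate extend))
    where
    extend : ∀ {t} → t ∈ filter (s ≺w?_) A → WeakChain A s (t ∷ bestTail n t)
    extend t∈ with ∈-filter⁻ (s ≺w?_) t∈
    ... | t∈A , s≺t = s∈A , s≺t , bestTail-chain n t∈A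

  bestTail-optimal : ∀ n {s rest} → WeakChain A s rest → length rest ≤ n →
                     coverage s rest ≤ coverage s (bestTail n s)
  bestTail-optimal zero    {rest = []}       _ _ = ≤-refl
  bestTail-optimal (suc n) {s} {[]}        _ _ = f[⊥]≤f[argmax] {f = coverage s} [] (extensions n s)
  bestTail-optimal (suc n) {s} {t ∷ rest} (_ , s≺t , w) (s≤s len) =
    v≤f[argmax]⁺ {f = coverage s} [] (extensions n s)
      (inj₂ (lose extension∈ (+-monoʳ-≤ (contribution s t) (bestTail-optimal n w len))))
    where
    extension∈ : t ∷ bestTail n t ∈ extensions n s
    extension∈ = ∈-map⁺ (λ t → t ∷ bestTail n t) (∈-filter⁺ (s ≺w?_) (WeakChain-head w) s≺t)

  optimalChain : ∀ n {s₀} → s₀ ∈ A →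
                 Σ Anchor λ s → Σ (List Anchor) λ rest → WeakChain A s rest ×
                   (∀ {s′ rest′} → WeakChain A s′ rest′ → length rest′ ≤ n →
                      coverage s′ rest′ ≤ coverage s rest)
  optimalChain n {s₀} s₀∈A = s , bestTail n s , bestTail-chain n s∈A , optimal
    where
    score : Anchor → ℕ
    score s = coverage s (bestTail n s)
    s : Anchor
    s = argmax score s₀ A
    s∈A : s ∈ A
    s∈A with argmax-sel score s₀ A
    ... | inj₁ s≡s₀ = subst (_∈ A) (sym s≡s₀) s₀∈A
    ... | inj₂ s∈   = s∈
    optimal : ∀ {s′ rest′} → WeakChain A s′ rest′ → length rest′ ≤ n → coverage s′ rest′ ≤ score s
    optimal w len =
      ≤-trans (bestTail-optimal n w len) (All.lookup (f[xs]≤f[argmax] s₀ A) (WeakChain-head w))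

module Alignment {Σ′ : Set} (T P : List Σ′) (A : List Anchor) (exact : All (ExactMatch T P) A) where

  exactMatch : ∀ {I} → I ∈ A → ExactMatch T P I
  exactMatch = All.lookup exact

  Anchored : ℕ → ℕ → Set
  Anchored i j = Σ Anchor λ I → (I ∈ A) × Σ ℕ λ x → (x ≤ b I ∸ a I) × (a I + x ≡ i) × (c I + x ≡ j)

  anchored-inRange : ∀ {i j} → Anchored i j → (1 ≤ i × i ≤ length T) × (1 ≤ j × j ≤ length P)
  anchored-inRange (I , I∈A , x , x≤ , refl , refl)
    with exactMatch I∈A
  ... | 1≤a , a≤b , b≤T , 1≤c , c≤d , d≤P , lengths , _ =
    (≤-trans 1≤a (m≤m+n _ x) , offset-≤ a≤b x≤ b≤T) ,
    (≤-trans 1≤c (m≤m+n _ x) , offset-≤ c≤d (subst (x ≤_) lengths x≤) d≤P)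

  anchored-symbol : ∀ {i j} → Anchored i j → Σ Σ′ λ σ → T at i ≡ just σ × P at j ≡ just σ
  anchored-symbol m@(I , I∈A , x , x≤ , refl , refl)
    with at-inRange T (a I + x) (proj₁ (anchored-inRange m)) | exactMatch I∈A
  ... | σ , T[i]≡σ | _ , _ , _ , _ , _ , _ , _ , agree =
    σ , T[i]≡σ , trans (sym (agree x x≤)) T[i]≡σ

  ARCS≥ : List Σ′ → ℕ → ℕ → Set
  ARCS≥ C i₀ j₀ = Σ (ARCS T P A C) λ (i , j , _) → ∀ k → i₀ ≤ i k × j₀ ≤ j k

  ARCS≥-[] : ∀ i₀ j₀ → ARCS≥ [] i₀ j₀
  ARCS≥-[] _ _ = ((λ ()) , (λ ()) , (λ ()) , (λ ()) , (λ ()) , (λ ()) , (λ ()) , (λ ())) , λ ()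

  ARCS≥-weaken : ∀ {C i₀ j₀ i₁ j₁} → i₀ ≤ i₁ → j₀ ≤ j₁ → ARCS≥ C i₁ j₁ → ARCS≥ C i₀ j₀
  ARCS≥-weaken i₀≤i₁ j₀≤j₁ (arcs , above) =
    arcs , λ k → ≤-trans i₀≤i₁ (proj₁ (above k)) , ≤-trans j₀≤j₁ (proj₂ (above k))

  ARCS≥-cons : ∀ {C i₀ j₀ i₁ j₁} (m : Anchored i₀ j₀) → i₀ < i₁ → j₀ < j₁ → ARCS≥ C i₁ j₁ →
               ARCS≥ (proj₁ (anchored-symbol m) ∷ C) i₀ j₀
  ARCS≥-cons {i₀ = i₀} {j₀} m i₀<i₁ j₀<j₁ ((i , j , i↑ , j↑ , i∈T , j∈P , symbols , anchored) , above) =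
    ( i₀ Vector.∷ i , j₀ Vector.∷ j
    , StrictlyIncreasing-cons i₀<i i↑ , StrictlyIncreasing-cons j₀<j j↑
    , ∀-cons (proj₁ (anchored-inRange m)) i∈T , ∀-cons (proj₂ (anchored-inRange m)) j∈P
    , ∀-cons (proj₂ (anchored-symbol m)) symbols , ∀-cons m anchored
    ) , ∀-cons (≤-refl , ≤-refl) (λ k → <⇒≤ (i₀<i k) , <⇒≤ (j₀<j k))
    where
    i₀<i : ∀ k → i₀ < i k
    i₀<i k = <-≤-trans i₀<i₁ (proj₁ (above k))
    j₀<j : ∀ k → j₀ < j k
    j₀<j k = <-≤-trans j₀<j₁ (proj₂ (above k))

  ARCS≥-prependAnchor : ∀ {s} → s ∈ A → ∀ m {C} → m ≤ suc (b s ∸ a s) →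
                        ARCS≥ C (a s + m) (c s + m) →
                        Σ (List Σ′) λ C′ → ARCS≥ C′ (a s) (c s) × length C′ ≡ m + length C
  ARCS≥-prependAnchor {s} s∈A zero {C} _ arcs =
    C , subst₂ (ARCS≥ C) (+-identityʳ (a s)) (+-identityʳ (c s)) arcs , refl
  ARCS≥-prependAnchor {s} s∈A (suc m) {C} m<len arcs
    with ARCS≥-prependAnchor s∈A m (≤-trans (n≤1+n m) m<len)
           (ARCS≥-cons {C} (s , s∈A , m , s≤s⁻¹ m<len , refl , refl)
                       (+-monoʳ-< (a s) ≤-refl) (+-monoʳ-< (c s) ≤-refl) arcs)
  ... | C′ , arcs′ , |C′| = C′ , arcs′ , trans |C′| (+-suc m (length C))

  chain⇒ARCS : ∀ {s rest} → WeakChain A s rest →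
               Σ (List Σ′) λ C → ARCS≥ C (a s) (c s) × length C ≡ coverage s rest
  chain⇒ARCS {s} {[]} s∈A
    with ARCS≥-prependAnchor s∈A (coverage s []) {[]}
           (≤-trans (m⊓n≤m _ _) (≤-reflexive (+-comm (b s ∸ a s) 1))) (ARCS≥-[] _ _)
  ... | C , arcs , |C| = C , arcs , trans |C| (+-identityʳ _)
  chain⇒ARCS {s} {t ∷ rest} (s∈A , (as<at , cs<ct) , w)
    with chain⇒ARCS w | exactMatch s∈A
  ... | C₁ , arcs₁ , |C₁| | _ , a≤b , _
    with ARCS≥-prependAnchor s∈A (contribution s t) {C₁} (contribution≤length s t a≤b)
           (ARCS≥-weaken {C₁} (a+contribution≤a s t (<⇒≤ as<at)) (c+contribution≤c s t (<⇒≤ cs<ct))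
                              arcs₁)
  ... | C , arcs , |C| = C , arcs , trans |C| (cong (contribution s t +_) |C₁|)

  Covers-single : ∀ {i j} (m : Anchored i j) → Covers 1 i j (proj₁ m) []
  Covers-single (I , I∈A , x , x≤ , refl , refl) with exactMatch I∈A
  ... | _ , _ , _ , _ , _ , _ , lengths , _ =
    ≤-trans (s≤s z≤n) 1+x≤cov , +-offset-≤ 1 x (a I) 1+x≤cov , +-offset-≤ 1 x (c I) 1+x≤cov
    where
    1+x≤ : ∀ {n} → x ≤ n → 1 + x ≤ n + 1
    1+x≤ {n} x≤n = ≤-trans (s≤s x≤n) (≤-reflexive (+-comm 1 n))
    1+x≤cov : 1 + x ≤ coverage I []
    1+x≤cov = ⊓-glb (1+x≤ x≤) (1+x≤ (subst (x ≤_) lengths x≤))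

  Covers-prepend : ∀ {n i₀ j₀ i₁ j₁ s rest} (m : Anchored i₀ j₀) → proj₁ m ≺w s → i₀ < i₁ → j₀ < j₁ →
                   Covers (suc n) i₁ j₁ s rest → Covers (suc (suc n)) i₀ j₀ (proj₁ m) (s ∷ rest)
  Covers-prepend {n} {s = s} {rest} (I , I∈A , x , x≤ , refl , refl) (aI<as , cI<cs) i₀<i₁ j₀<j₁
                 (n<cov , rowReach , colReach)
    with exactMatch I∈A
  ... | _ , a≤b , _ , _ , c≤d , _ , lengths , _ =
    ≤-trans (m≤m+n _ x) gain , +-offset-≤ (2 + n) x (a I) gain , +-offset-≤ (2 + n) x (c I) gain
    where
    cov = coverage s rest
    gain : suc (suc n) + x ≤ coverage I (s ∷ rest)
    gain = begin
      suc (suc n) + x                                                    ≤⟨ ⊓-glb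
        (prepend-gain a≤b x≤ aI<as i₀<i₁ n<cov rowReach)
        (prepend-gain c≤d (subst (x ≤_) lengths x≤) cI<cs j₀<j₁ n<cov colReach) ⟩
      ((a s ⊓ (b I + 1)) ∸ a I + cov) ⊓ ((c s ⊓ (d I + 1)) ∸ c I + cov) ≡⟨ sym (+-distribʳ-⊓ cov _ _) ⟩
      coverage I (s ∷ rest)                                              ∎

  Covers-skip : ∀ {n i₀ j₀ i₁ j₁ s rest} (m : Anchored i₀ j₀) → ¬ proj₁ m ≺w s → i₀ < i₁ → j₀ < j₁ →
                Covers (suc n) i₁ j₁ s rest → Covers (suc (suc n)) i₀ j₀ s rest
  Covers-skip {n} {s = s} {rest} (I , _ , x , _ , refl , refl) I⊀s i₀<i₁ j₀<j₁
              (_ , rowReach , colReach) =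
    n<cov , +-shift-< (suc n) i₀<i₁ rowReach , +-shift-< (suc n) j₀<j₁ colReach
    where
    n<cov : suc (suc n) ≤ coverage s rest
    n<cov with ⊀w⇒≥ {I} {s} I⊀s
    ... | inj₁ as≤aI = +-shift-≤ (suc n) (≤-trans as≤aI (m≤m+n _ x)) i₀<i₁ rowReach
    ... | inj₂ cs≤cI = +-shift-≤ (suc n) (≤-trans cs≤cI (m≤m+n _ x)) j₀<j₁ colReach

  matches⇒chain : ∀ n (i j : Fin (suc n) → ℕ) → StrictlyIncreasing i → StrictlyIncreasing j →
                  (∀ k → Anchored (i k) (j k)) →
                  Σ Anchor λ s → Σ (List Anchor) λ rest →
                    WeakChain A s rest × Covers (suc n) (i Fin.zero) (j Fin.zero) s rest
  matches⇒chain zero i j _ _ anchored =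
    proj₁ m , [] , proj₁ (proj₂ m) , Covers-single m
    where m = anchored Fin.zero
  matches⇒chain (suc n) i j i↑ j↑ anchored
    with matches⇒chain n (Vector.tail i) (Vector.tail j)
           (StrictlyIncreasing-tail i↑) (StrictlyIncreasing-tail j↑) (anchored ∘ Fin.suc)
       | anchored Fin.zero
  ... | s , rest , w , covers | m@(I , I∈A , _) with I ≺w? s
  ... | yes I≺s = I , s ∷ rest , (I∈A , I≺s , w) ,
                  Covers-prepend {rest = rest} m I≺s i₀<i₁ j₀<j₁ covers
    where
    i₀<i₁ = StrictlyIncreasing-head i↑
    j₀<j₁ = StrictlyIncreasing-head j↑
  ... | no  I⊀s = s , rest , w , Covers-skip {s = s} {rest} m I⊀s i₀<i₁ j₀<j₁ covers
    where
    i₀<i₁ = StrictlyIncreasing-head i↑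
    j₀<j₁ = StrictlyIncreasing-head j↑

  chain-length≤ : ∀ {s rest} → WeakChain A s rest → length rest ≤ length T
  chain-length≤ {s} {rest} w with exactMatch (WeakChain-last w)
  ... | _ , a≤b , b≤T , _ = begin
    length rest                ≤⟨ m≤m+n _ _ ⟩
    length rest + a s          ≤⟨ WeakChain-length w ⟩
    a (last s rest)            ≤⟨ a≤b ⟩
    b (last s rest)            ≤⟨ b≤T ⟩
    length T                   ∎

  ARCS-length≤ : ∀ {ℓ} → (∀ {s rest} → WeakChain A s rest → coverage s rest ≤ ℓ) →
                 ∀ C → ARCS T P A C → length C ≤ ℓ
  ARCS-length≤ {ℓ} bounded C (i , j , i↑ , j↑ , _ , _ , _ , anchored) =
    matches≤ (length C) i j i↑ j↑ anchored
    where
    matches≤ : ∀ n (i j : Fin n → ℕ) → StrictlyIncreasing i → StrictlyIncreasing j →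
               (∀ k → Anchored (i k) (j k)) → n ≤ ℓ
    matches≤ zero    _ _ _  _  _        = z≤n
    matches≤ (suc n) i j i↑ j↑ anchored with matches⇒chain n i j i↑ j↑ anchored
    ... | _ , _ , w , n<cov , _ = ≤-trans n<cov (bounded w)

theorem3 : {Σ′ : Set} (T P : List Σ′) (A : List Anchor) →
    1 ≤ length A →
    All (ExactMatch T P) A →
    Σ ℕ λ ℓ → IsMaxChainCoverage A ℓ × IsARLCSLength T P A ℓ
theorem3 T P []          () _
theorem3 T P A@(_ ∷ _) _  exact =
  let open Alignment T P A exact
      (s , rest , w , optimal) = OptimalChain.optimalChain A (length T) (here refl)
      maximal : ∀ {s′ rest′} → WeakChain A s′ rest′ → coverage s′ rest′ ≤ coverage s rest
      maximal w′ = optimal w′ (chain-length≤ w′)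
      (C , (arcs , _) , |C|) = chain⇒ARCS w
  in coverage s rest ,
     ((s , rest , w , WeakChain-last w , refl) , λ _ _ w′ _ → maximal w′) ,
     ((C , arcs , |C|) , ARCS-length≤ maximal)
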